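{- Let $m$ and $k$ be positive integers. Then \[ \big(\mathfrak{E}\,R(\hbar;k,-\tfrac12,i_1,\dots,i_m)\big)\Big|_{i_1=\dots=i_m=k}=\binom m2 k^2\hbar, \] where $\mathfrak E=\sum_{j=1}^m i_j\Delta_{i_j}$.
   Context: $R(\hbar;k,l,i_1,\dots,i_m)=\prod_{j=1}^m\prod_{\gamma_j=0}^{k-i_j-1}\big(1+\hbar(l-i_{j+1}-\dots-i_m+\gamma_j+\tfrac12)\big)$ for integers $0\leq i_j\leq k$. $\Delta_{i_j}$ is the backward difference in the variable $i_j$: $\Delta_{i_j}f(i_1,\dots,i_m)=f(\dots,i_j,\dots)-f(\dots,i_j-1,\dots)$. -}

module Defs where

open import Data.Nat as ℕ using (ℕ; _∸_; _<ᵇ_)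
open import Data.Fin using (Fin; toℕ; _≟_)
open import Data.List using (List; upTo; allFin; map; foldr)
open import Data.Bool using (if_then_else_)
open import Data.Integer using (+_)
open import Data.Rational using (ℚ; _+_; _*_; _-_; 0ℚ; 1ℚ; ½; _/_)
open import Relation.Nullary using (does)

ℕtoℚ : ℕ → ℚ
ℕtoℚ n = (+ n) / 1

Σℚ : List ℚ → ℚ
Σℚ = foldr _+_ 0ℚ

Πℚ : List ℚ → ℚ
Πℚ = foldr _*_ 1ℚ

tailSum : {m : ℕ} → (Fin m → ℕ) → Fin m → ℕ
tailSum {m} i j = foldr ℕ._+_ 0
  (map (λ j′ → if toℕ j <ᵇ toℕ j′ then i j′ else 0) (allFin m))

R : {m : ℕ} → (ħ : ℚ) (k : ℕ) (l : ℚ) → (Fin m → ℕ) → ℚ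
R {m} ħ k l i = Πℚ (map (λ j →
    Πℚ (map (λ γ → 1ℚ + ħ * (((l - ℕtoℚ (tailSum i j)) + ℕtoℚ γ) + ½))
            (upTo (k ∸ i j))))
  (allFin m))

decAt : {m : ℕ} → (Fin m → ℕ) → Fin m → Fin m → ℕ
decAt i j j′ = if does (j′ ≟ j) then i j′ ∸ 1 else i j′

Δ : {m : ℕ} → Fin m → ((Fin m → ℕ) → ℚ) → (Fin m → ℕ) → ℚ
Δ j f i = f i - f (decAt i j)

𝔈 : {m : ℕ} → ((Fin m → ℕ) → ℚ) → (Fin m → ℕ) → ℚ
𝔈 {m} f i = Σℚ (map (λ j → ℕtoℚ (i j) * Δ j f i) (allFin m))

-- At the constant point i = (k, …, k) every inner product of R is empty, so R = 1.
-- Lowering i_j by one leaves exactly one factor, γ = 0 of the j-th block,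
-- 1 + ħ (l − T_j + ½), where the tail sum T_j = (m − 1 − j) k is unaffected by the change.
-- For l = −½ the j-th term of 𝔈 is therefore k · ħ · T_j, and Σ_j (m − 1 − j) = C(m, 2).

module Submission where

open import Defs
open import Data.Nat using (ℕ; _≥_; _*_; _^_)
open import Data.Nat.Combinatorics using (_C_)
open import Data.Rational using (ℚ; -½) renaming (_*_ to _*ℚ_)
open import Relation.Binary.PropositionalEquality using (_≡_)

open import Data.Bool using (if_then_else_; false)
open import Data.Fin using (Fin; toℕ; _≟_) renaming (zero to fzero; suc to fsuc)
open import Data.Fin.Properties using (suc-injective)
import Data.Integer as ℤ
import Data.Integer.Properties as ℤ
open import Data.List using ([]; _∷_; map; tabulate; allFin; upTo)
open import Data.List.Properties using (map-cong; map-tabulate)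
import Data.Nat as ℕ
open import Data.Nat using (_∸_; _<ᵇ_)
open import Data.Nat.Combinatorics using (nC1≡n; nCk+nC[k+1]≡[n+1]C[k+1])
open import Data.Nat.Coprimality using (1-coprimeTo) renaming (sym to coprime-sym)
open import Data.Nat.ListAction using (sum)
import Data.Nat.Properties as ℕ
open import Data.Rational using (mkℚ; 1ℚ; ½; _+_; _-_)
import Data.Rational.Properties as ℚ
open import Data.Rational.Solver using (module +-*-Solver)
open import Function using (id; _∘_)
open import Relation.Binary.PropositionalEquality
  using (refl; sym; trans; cong; cong₂; _≢_; module ≡-Reasoning)
open import Relation.Nullary using (yes; no; contradiction)

private
  variable
    A : Set

ℕtoℚ≡mkℚ : ∀ n → ℕtoℚ n ≡ mkℚ (ℤ.+ n) 0 (coprime-sym (1-coprimeTo n))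
ℕtoℚ≡mkℚ n = ℚ.↥p/↧p≡p (mkℚ (ℤ.+ n) 0 (coprime-sym (1-coprimeTo n)))

-- On arguments of the form mkℚ (+ _) 0 _ the rational sum and product unfold to
-- (numerator) / (1 * 1), so only the numerators need comparing.
ℕtoℚ-+ : ∀ m n → ℕtoℚ (m ℕ.+ n) ≡ ℕtoℚ m + ℕtoℚ n
ℕtoℚ-+ m n = sym (trans (cong₂ _+_ (ℕtoℚ≡mkℚ m) (ℕtoℚ≡mkℚ n))
  (ℚ./-cong (cong₂ ℤ._+_ (ℤ.*-identityʳ (ℤ.+ m)) (ℤ.*-identityʳ (ℤ.+ n))) refl))

ℕtoℚ-* : ∀ m n → ℕtoℚ (m * n) ≡ ℕtoℚ m *ℚ ℕtoℚ n
ℕtoℚ-* m n = sym (trans (cong₂ _*ℚ_ (ℕtoℚ≡mkℚ m) (ℕtoℚ≡mkℚ n))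
  (ℚ./-cong (sym (ℤ.pos-* m n)) refl))

Σℚ-map-ℕtoℚ : ∀ (f : A → ℕ) xs → Σℚ (map (ℕtoℚ ∘ f) xs) ≡ ℕtoℚ (sum (map f xs))
Σℚ-map-ℕtoℚ f []       = refl
Σℚ-map-ℕtoℚ f (x ∷ xs) =
  trans (cong (ℕtoℚ (f x) +_) (Σℚ-map-ℕtoℚ f xs)) (sym (ℕtoℚ-+ (f x) _))

Σℚ-map-*ˡ : ∀ c (f : A → ℚ) xs → Σℚ (map (λ x → c *ℚ f x) xs) ≡ c *ℚ Σℚ (map f xs)
Σℚ-map-*ˡ c f []       = sym (ℚ.*-zeroʳ c)
Σℚ-map-*ˡ c f (x ∷ xs) =
  trans (cong (c *ℚ f x +_) (Σℚ-map-*ˡ c f xs)) (sym (ℚ.*-distribˡ-+ c (f x) _))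

Πℚ-tabulate-1 : ∀ {m} (f : Fin m → ℚ) → (∀ j → f j ≡ 1ℚ) → Πℚ (tabulate f) ≡ 1ℚ
Πℚ-tabulate-1 {ℕ.zero}  f f≡1 = refl
Πℚ-tabulate-1 {ℕ.suc m} f f≡1 =
  cong₂ _*ℚ_ (f≡1 fzero) (Πℚ-tabulate-1 (f ∘ fsuc) (f≡1 ∘ fsuc))

Πℚ-tabulate-single : ∀ {m} (f : Fin m → ℚ) j → (∀ j′ → j′ ≢ j → f j′ ≡ 1ℚ) →
                     Πℚ (tabulate f) ≡ f j
Πℚ-tabulate-single {ℕ.suc m} f fzero    f≡1 = trans
  (cong (f fzero *ℚ_) (Πℚ-tabulate-1 (f ∘ fsuc) (λ j′ → f≡1 (fsuc j′) λ ())))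
  (ℚ.*-identityʳ (f fzero))
Πℚ-tabulate-single {ℕ.suc m} f (fsuc j) f≡1 = trans
  (cong₂ _*ℚ_ (f≡1 fzero λ ())
              (Πℚ-tabulate-single (f ∘ fsuc) j (λ j′ j′≢j → f≡1 (fsuc j′) (j′≢j ∘ suc-injective))))
  (ℚ.*-identityˡ _)

sum-map-*ʳ : ∀ (f : A → ℕ) c xs → sum (map (λ x → f x * c) xs) ≡ sum (map f xs) * c
sum-map-*ʳ f c []       = refl
sum-map-*ʳ f c (x ∷ xs) =
  trans (cong (f x * c ℕ.+_) (sum-map-*ʳ f c xs)) (sym (ℕ.*-distribʳ-+ c (f x) _))

sum-tabulate-const : ∀ m c → sum (tabulate {n = m} (λ _ → c)) ≡ m * c
sum-tabulate-const ℕ.zero    c = refl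
sum-tabulate-const (ℕ.suc m) c = cong (c ℕ.+_) (sum-tabulate-const m c)

sum-tabulate-<ᵇ : ∀ m a c →
                  sum (tabulate {n = m} (λ j → if a <ᵇ toℕ j then c else 0)) ≡ (m ∸ ℕ.suc a) * c
sum-tabulate-<ᵇ ℕ.zero    a         c = refl
sum-tabulate-<ᵇ (ℕ.suc m) ℕ.zero    c = sum-tabulate-const m c
sum-tabulate-<ᵇ (ℕ.suc m) (ℕ.suc a) c = sum-tabulate-<ᵇ m a c

sum-tabulate-∸suc≡C2 : ∀ m → sum (tabulate {n = m} (λ j → m ∸ ℕ.suc (toℕ j))) ≡ m C 2
sum-tabulate-∸suc≡C2 ℕ.zero    = refl
sum-tabulate-∸suc≡C2 (ℕ.suc m) = begin
  m ℕ.+ sum (tabulate {n = m} (λ j → m ∸ ℕ.suc (toℕ j))) ≡⟨ cong (m ℕ.+_) (sum-tabulate-∸suc≡C2 m) ⟩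
  m ℕ.+ m C 2                                            ≡⟨ cong (ℕ._+ m C 2) (nC1≡n m) ⟨
  m C 1 ℕ.+ m C 2                                        ≡⟨ nCk+nC[k+1]≡[n+1]C[k+1] m 1 ⟩
  ℕ.suc m C 2                                            ∎
  where open ≡-Reasoning

sum-allFin-∸suc*≡C2* : ∀ m c → sum (map (λ j → (m ∸ ℕ.suc (toℕ j)) * c) (allFin m)) ≡ (m C 2) * c
sum-allFin-∸suc*≡C2* m c = begin
  sum (map (λ j → n j * c) (allFin m)) ≡⟨ sum-map-*ʳ n c (allFin m) ⟩
  sum (map n (allFin m)) * c           ≡⟨ cong (λ x → sum x * c) (map-tabulate id n) ⟩
  sum (tabulate n) * c                 ≡⟨ cong (_* c) (sum-tabulate-∸suc≡C2 m) ⟩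
  (m C 2) * c                          ∎
  where
  open ≡-Reasoning
  n : Fin m → ℕ
  n j = m ∸ ℕ.suc (toℕ j)

n<ᵇn≡false : ∀ n → (n <ᵇ n) ≡ false
n<ᵇn≡false ℕ.zero    = refl
n<ᵇn≡false (ℕ.suc n) = n<ᵇn≡false n

tailSum-decAt : ∀ {m} (i : Fin m → ℕ) j → tailSum (decAt i j) j ≡ tailSum i j
tailSum-decAt {m} i j = cong sum (map-cong same-summand (allFin m))
  where
  same-summand : ∀ j′ → (if toℕ j <ᵇ toℕ j′ then decAt i j j′ else 0)
                      ≡ (if toℕ j <ᵇ toℕ j′ then i j′ else 0)
  same-summand j′ with j′ ≟ j
  ... | yes refl rewrite n<ᵇn≡false (toℕ j) = refl
  ... | no _     = refl

tailSum-const : ∀ {m} k (j : Fin m) → tailSum (λ _ → k) j ≡ (m ∸ ℕ.suc (toℕ j)) * k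
tailSum-const {m} k j =
  trans (cong sum (map-tabulate {n = m} id (λ j′ → if toℕ j <ᵇ toℕ j′ then k else 0)))
        (sum-tabulate-<ᵇ m (toℕ j) k)

R-const : ∀ {m} ħ k l → R {m} ħ k l (λ _ → k) ≡ 1ℚ
R-const {m} ħ k l rewrite ℕ.n∸n≡0 k =
  trans (cong Πℚ (map-tabulate {n = m} id (λ _ → 1ℚ))) (Πℚ-tabulate-1 {m} (λ _ → 1ℚ) (λ _ → refl))

R-decAt-const : ∀ {m} ħ k l (j : Fin m) →
                R ħ (ℕ.suc k) l (decAt (λ _ → ℕ.suc k) j)
                  ≡ 1ℚ + ħ *ℚ ((l - ℕtoℚ (tailSum (λ _ → ℕ.suc k) j)) + ½)
R-decAt-const {m} ħ k l j = begin
  Πℚ (map block (allFin m))  ≡⟨ cong Πℚ (map-tabulate id block) ⟩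
  Πℚ (tabulate block)        ≡⟨ Πℚ-tabulate-single block j other-blocks≡1 ⟩
  block j                    ≡⟨ block-j ⟩
  factor j 0 *ℚ 1ℚ           ≡⟨ ℚ.*-identityʳ (factor j 0) ⟩
  factor j 0                 ≡⟨ cong (λ t → 1ℚ + ħ *ℚ (t + ½))
                                     (trans (ℚ.+-identityʳ _)
                                            (cong (λ n → l - ℕtoℚ n) (tailSum-decAt i j))) ⟩
  1ℚ + ħ *ℚ ((l - ℕtoℚ (tailSum i j)) + ½) ∎
  where
  open ≡-Reasoning
  i : Fin m → ℕ
  i _ = ℕ.suc k
  factor : Fin m → ℕ → ℚ
  factor j′ γ = 1ℚ + ħ *ℚ (((l - ℕtoℚ (tailSum (decAt i j) j′)) + ℕtoℚ γ) + ½)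
  block : Fin m → ℚ
  block j′ = Πℚ (map (factor j′) (upTo (ℕ.suc k ∸ decAt i j j′)))
  other-blocks≡1 : ∀ j′ → j′ ≢ j → block j′ ≡ 1ℚ
  other-blocks≡1 j′ j′≢j with j′ ≟ j
  ... | yes j′≡j = contradiction j′≡j j′≢j
  ... | no _ rewrite ℕ.n∸n≡0 k = refl
  block-j : block j ≡ factor j 0 *ℚ 1ℚ
  block-j with j ≟ j
  ... | yes _   rewrite ℕ.m+n∸n≡m 1 k = refl
  ... | no j≢j = contradiction refl j≢j

Δ-R-const : ∀ {m} ħ k l (j : Fin m) →
            Δ j (R ħ (ℕ.suc k) l) (λ _ → ℕ.suc k)
              ≡ ħ *ℚ (ℕtoℚ ((m ∸ ℕ.suc (toℕ j)) * ℕ.suc k) - (l + ½))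
Δ-R-const {m} ħ k l j = begin
  R ħ K l i - R ħ K l (decAt i j)      ≡⟨ cong₂ _-_ (R-const {m} ħ K l) (R-decAt-const ħ k l j) ⟩
  1ℚ - (1ℚ + ħ *ℚ ((l - T) + ½))       ≡⟨ solve 4 (λ h l T c → con 1ℚ :- (con 1ℚ :+ h :* ((l :- T) :+ c))
                                                     := h :* (T :- (l :+ c)))
                                                 refl ħ l T ½ ⟩
  ħ *ℚ (T - (l + ½))                   ≡⟨ cong (λ n → ħ *ℚ (ℕtoℚ n - (l + ½))) (tailSum-const K j) ⟩
  ħ *ℚ (ℕtoℚ ((m ∸ ℕ.suc (toℕ j)) * K) - (l + ½)) ∎
  where
  open ≡-Reasoning
  open +-*-Solver
  K : ℕ
  K = ℕ.suc k
  i : Fin m → ℕ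
  i _ = K
  T : ℚ
  T = ℕtoℚ (tailSum i j)

k*Δ-R-const[-½] : ∀ {m} ħ k (j : Fin m) →
                  ℕtoℚ (ℕ.suc k) *ℚ Δ j (R ħ (ℕ.suc k) -½) (λ _ → ℕ.suc k)
                    ≡ ħ *ℚ ℕtoℚ ((m ∸ ℕ.suc (toℕ j)) * ℕ.suc k ^ 2)
k*Δ-R-const[-½] {m} ħ k j = begin
  ℕtoℚ K *ℚ Δ j (R ħ K -½) (λ _ → K)            ≡⟨ cong (ℕtoℚ K *ℚ_) (Δ-R-const ħ k -½ j) ⟩
  ℕtoℚ K *ℚ (ħ *ℚ (ℕtoℚ (n * K) - (-½ + ½)))    ≡⟨ solve 3 (λ K h N → K :* (h :* (N :- (con -½ :+ con ½)))
                                                               := h :* (N :* K))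
                                                          refl (ℕtoℚ K) ħ (ℕtoℚ (n * K)) ⟩
  ħ *ℚ (ℕtoℚ (n * K) *ℚ ℕtoℚ K)                 ≡⟨ cong (ħ *ℚ_) (ℕtoℚ-* (n * K) K) ⟨
  ħ *ℚ ℕtoℚ (n * K * K)                         ≡⟨ cong (λ x → ħ *ℚ ℕtoℚ x) n*K*K≡n*K² ⟩
  ħ *ℚ ℕtoℚ (n * K ^ 2)                         ∎
  where
  open ≡-Reasoning
  open +-*-Solver
  K : ℕ
  K = ℕ.suc k
  n : ℕ
  n = m ∸ ℕ.suc (toℕ j)
  n*K*K≡n*K² : n * K * K ≡ n * K ^ 2
  n*K*K≡n*K² = trans (ℕ.*-assoc n K K) (cong (λ y → n * (K * y)) (sym (ℕ.*-identityʳ K)))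

proposition5p16 : (m k : ℕ) → m ≥ 1 → k ≥ 1 → (ħ : ℚ) →
    𝔈 {m} (R ħ k -½) (λ _ → k) ≡ ℕtoℚ ((m C 2) * k ^ 2) *ℚ ħ
proposition5p16 m K@(ℕ.suc k) _ _ ħ = begin
  Σℚ (map (λ j → ℕtoℚ K *ℚ Δ j (R ħ K -½) (λ _ → K)) (allFin m))
    ≡⟨ cong Σℚ (map-cong (k*Δ-R-const[-½] ħ k) (allFin m)) ⟩
  Σℚ (map (λ j → ħ *ℚ ℕtoℚ (n j * K ^ 2)) (allFin m))
    ≡⟨ Σℚ-map-*ˡ ħ (λ j → ℕtoℚ (n j * K ^ 2)) (allFin m) ⟩
  ħ *ℚ Σℚ (map (λ j → ℕtoℚ (n j * K ^ 2)) (allFin m))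
    ≡⟨ cong (ħ *ℚ_) (Σℚ-map-ℕtoℚ (λ j → n j * K ^ 2) (allFin m)) ⟩
  ħ *ℚ ℕtoℚ (sum (map (λ j → n j * K ^ 2) (allFin m)))
    ≡⟨ cong (λ x → ħ *ℚ ℕtoℚ x) (sum-allFin-∸suc*≡C2* m (K ^ 2)) ⟩
  ħ *ℚ ℕtoℚ ((m C 2) * K ^ 2)
    ≡⟨ ℚ.*-comm ħ _ ⟩
  ℕtoℚ ((m C 2) * K ^ 2) *ℚ ħ ∎
  where
  open ≡-Reasoning
  n : Fin m → ℕ
  n j = m ∸ ℕ.suc (toℕ j)
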